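{- Let $f:\{0,1\}^n\to\{0,1\}$ be a non-constant monotone Boolean function. Then \[ \mathrm{Arith}\big(\mathrm{Env}(\mathrm{Low}(f))\big)\leq \mathrm{Read}_1(f)\leq \mathrm{sRead}_1(f)\leq \mathrm{Arith}(\mathrm{Low}(f)). \] In particular, if $f$ is homogeneous, then $\mathrm{Arith}(\mathrm{Low}(f))=\mathrm{Read}_1(f)=\mathrm{sRead}_1(f)$.
   Context: A monotone Boolean circuit is a directed acyclic graph (parallel edges allowed) whose indegree-zero nodes hold variables among $x_1,\dots,x_n$ (no constant inputs) and whose other nodes (gates) have indegree two and are labeled $\lor$ or $\land$; its size is the number of gates. The set $B_F\subseteq\mathbb{N}^n$ of exponent vectors produced by a circuit $F$ is defined inductively: for $F=x_i$, $B_F=\{e_i\}$ (the $i$th unit vector); for $F=G\lor H$, $B_F=B_G\cup B_H$; for $F=G\land H$, $B_F=B_G+B_H=\{b+c: b\in B_G, c\in B_H\}$. (For an arithmetic $(+,\times)$ circuit the same rules with $+$ in place of $\lor$ and $\times$ in place of $\land$ give the set of exponent vectors of the polynomial it produces, i.e. the formal expansion without any cancellation or merging of terms.) The support of $a\in\mathbb{N}^n$ is $\mathrm{supp}(a)=\{i:a_i\neq 0\}$. For a monotone Boolean function $f$, $\mathrm{Low}(f)$ is the set of $a\in\{0,1\}^n$ with $f(a)=1$ and $f(b)=0$ for all $b\leq a$, $b\neq a$ (componentwise order). A monotone Boolean circuit $F$ computing $f$ is a read-$k$ circuit if for every $a\in\mathrm{Low}(f)$ there is $b\in B_F$ with $\mathrm{supp}(b)=\mathrm{supp}(a)$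 and $b_i\leq k$ for all $i$; it is syntactically read-$k$ if every vector in $B_F$ has all entries $\leq k$. $\mathrm{Read}_k(f)$ (resp. $\mathrm{sRead}_k(f)$) is the minimum size of a monotone read-$k$ (resp. syntactically read-$k$) circuit computing $f$. For a finite $A\subseteq\mathbb{N}^n$, $\mathrm{Arith}(A)$ is the minimum size of a monotone arithmetic $(+,\times)$ circuit with only variables as inputs that produces a polynomial $\sum_{a\in A}c_a\prod_i x_i^{a_i}$ with integer coefficients $c_a\geq 1$ (i.e. whose set of produced exponent vectors is exactly $A$). The degree of $a\in\mathbb{N}^n$ is $|a|=a_1+\dots+a_n$, and the lower envelope $\mathrm{Env}(A)$ is the set of vectors of $A$ of minimum degree. $f$ is homogeneous if all vectors in $\mathrm{Low}(f)$ have the same degree. -}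

module Defs where

open import Data.Nat using (ℕ; zero; suc; _+_; _≤_; _≡ᵇ_)
open import Data.Fin using (Fin; zero; suc; _≟_)
open import Data.Bool using (Bool; true; false; _∨_; _∧_; if_then_else_)
open import Data.Sum using (_⊎_; inj₁; inj₂)
open import Data.Product using (Σ; Σ-syntax; _×_; _,_)
open import Relation.Binary.PropositionalEquality using (_≡_)
open import Relation.Nullary using (¬_; does)
open import Function using (_∘_)

Exp : ℕ → Set
Exp n = Fin n → ℕ

ExpSet : ℕ → Set₁
ExpSet n = Exp n → Set

_≈ₑ_ : ∀ {n} → Exp n → Exp n → Set
a ≈ₑ b = ∀ i → a i ≡ b i

unit : ∀ {n} → Fin n → Exp n
unit i j = if does (i ≟ j) then 1 else 0

deg : ∀ {n} → Exp n → ℕ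
deg {zero}  a = 0
deg {suc n} a = a zero + deg (a ∘ suc)

SameSupp : ∀ {n} → Exp n → Exp n → Set
SameSupp a b = ∀ i → (a i ≡ 0 → b i ≡ 0) × (b i ≡ 0 → a i ≡ 0)

Env : ∀ {n} → ExpSet n → ExpSet n
Env A a = A a × (∀ b → A b → deg a ≤ deg b)

-- Circuits (DAGs given as straight-line programs; sharing allowed).
-- Binary gate operation: ⊕ is ∨ (Boolean) / + (arithmetic),
-- ⊗ is ∧ (Boolean) / × (arithmetic).

data Op : Set where
  ⊕ ⊗ : Op

Node : ℕ → ℕ → Set
Node n k = Fin n ⊎ Fin k

record Gate (n k : ℕ) : Set where
  constructor gate
  field
    op    : Op
    left  : Node n k
    right : Node n k

-- Gates s : list of s gates, each gate referring only to input nodes and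
-- earlier gates.  In (G ▷ g), gate index zero is g, suc i is gate i of G.
data Gates (n : ℕ) : ℕ → Set where
  []  : Gates n 0
  _▷_ : ∀ {k} → Gates n k → Gate n k → Gates n (suc k)

record Circuit (n s : ℕ) : Set where
  constructor circuit
  field
    gates  : Gates n s
    output : Node n s

open Circuit public

Bnode : ∀ {n k} → Gates n k → Node n k → ExpSet n
Bop : ∀ {n k} → Gates n k → Gate n k → ExpSet n
Bnode G (inj₁ i) b = b ≈ₑ unit i
Bnode (G ▷ g) (inj₂ zero) b = Bop G g b
Bnode (G ▷ g) (inj₂ (suc j)) b = Bnode G (inj₂ j) b
Bop G (gate ⊕ l r) b = Bnode G l b ⊎ Bnode G r b
Bop G (gate ⊗ l r) b =
  Σ[ c ∈ Exp _ ] Σ[ d ∈ Exp _ ]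
    (Bnode G l c × Bnode G r d × (∀ i → b i ≡ c i + d i))

B : ∀ {n s} → Circuit n s → ExpSet n
B C = Bnode (gates C) (output C)

evalNode : ∀ {n k} → Gates n k → Node n k → (Fin n → Bool) → Bool
evalOp : ∀ {n k} → Gates n k → Gate n k → (Fin n → Bool) → Bool
evalNode G (inj₁ i) x = x i
evalNode (G ▷ g) (inj₂ zero) x = evalOp G g x
evalNode (G ▷ g) (inj₂ (suc j)) x = evalNode G (inj₂ j) x
evalOp G (gate ⊕ l r) x = evalNode G l x ∨ evalNode G r x
evalOp G (gate ⊗ l r) x = evalNode G l x ∧ evalNode G r x

BoolFn : ℕ → Set
BoolFn n = (Fin n → Bool) → Bool

Monotone : ∀ {n} → BoolFn n → Set
Monotone f = ∀ x y → (∀ i → x i ≡ true → y i ≡ true) → f x ≡ true → f y ≡ true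

NonConstant : ∀ {n} → BoolFn n → Set
NonConstant f = Σ[ x ∈ _ ] f x ≡ true × Σ[ y ∈ _ ] f y ≡ false

bits : ∀ {n} → Exp n → (Fin n → Bool)
bits a i = a i ≡ᵇ 1

Low : ∀ {n} → BoolFn n → ExpSet n
Low f a =
  (∀ i → a i ≤ 1) × f (bits a) ≡ true ×
  (∀ b → (∀ i → b i ≤ a i) → ¬ (b ≈ₑ a) → f (bits b) ≡ false)

Homogeneous : ∀ {n} → BoolFn n → Set
Homogeneous f = ∀ a b → Low f a → Low f b → deg a ≡ deg b

Computes : ∀ {n s} → Circuit n s → BoolFn n → Set
Computes C f = ∀ x → evalNode (gates C) (output C) x ≡ f x

IsReadK : ∀ {n s} → ℕ → Circuit n s → BoolFn n → Set
IsReadK k C f =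
  ∀ a → Low f a → Σ[ b ∈ Exp _ ] (B C b × SameSupp b a × (∀ i → b i ≤ k))

IsSynReadK : ∀ {n s} → ℕ → Circuit n s → Set
IsSynReadK k C = ∀ b → B C b → ∀ i → b i ≤ k

ReadSize : ∀ {n} → ℕ → BoolFn n → ℕ → Set
ReadSize {n} k f s = Σ[ C ∈ Circuit n s ] (Computes C f × IsReadK k C f)

SReadSize : ∀ {n} → ℕ → BoolFn n → ℕ → Set
SReadSize {n} k f s = Σ[ C ∈ Circuit n s ] (Computes C f × IsSynReadK k C)

ArithSize : ∀ {n} → ExpSet n → ℕ → Set
ArithSize {n} A s = Σ[ C ∈ Circuit n s ] (∀ b → (B C b → A b) × (A b → B C b))

IsMin : (ℕ → Set) → ℕ → Set
IsMin P m = P m × (∀ s → P s → m ≤ s)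

-- A monotone circuit accepts x exactly when some vector it produces has its support inside
-- x. Hence every minterm of f is the support of a produced vector and every produced vector
-- lies above a minterm. A circuit producing exactly Low(f) therefore computes f and is
-- syntactically read-1; a syntactically read-1 circuit produces every minterm itself; and a
-- read-1 circuit produces every minterm while all its other vectors dominate one, so the
-- lowest-degree vectors it produces are exactly Env(Low(f)). Finally, discarding at every
-- ∨-gate the inputs whose least degree is not minimal leaves a circuit of the same size that
-- produces exactly the lowest-degree part of what the original produced.

{-# OPTIONS --safe #-}
module Submission where

open import Defs
open import Data.Nat using (ℕ; zero; suc; _+_; _∸_; _⊓_; _≤_; _<_; z≤n; s≤s; _≡ᵇ_)
open import Data.Nat.Properties
  using ( ≤-refl; ≤-reflexive; ≤-trans; ≤-antisym; ≤-total; <⇒≤; <⇒≱; <-irrefl; <-≤-trans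
        ; <-cmp; ≤∧≢⇒<; n<1⇒n≡0; m≤n⇒m<n∨m≡n; +-mono-≤; +-mono-<-≤; +-mono-≤-<; +-monoʳ-≤
        ; +-cancelʳ-≤; +-cancelˡ-≡; m+n≡0⇒m≡0; m+n≡0⇒n≡0; m∸n≤m
        ; m≤n⇒m⊓n≡m; m≥n⇒m⊓n≡n; m⊓n≤m; m⊓n≤n; m⊓n≡m⇒m≤n; ⊓-comm; ≡ᵇ⇒≡; ≡⇒≡ᵇ
        ; +-commutativeSemigroup )
  renaming (_≟_ to _≟ℕ_)
open import Data.Fin using (Fin; zero; suc; _≟_)
open import Data.Fin.Properties using (any?; all?; ¬∀⟶∃¬)
open import Data.Bool using (Bool; true; false; not; _∨_; if_then_else_)
open import Data.Bool.Properties using (∨-zeroʳ; ∧-conicalˡ; ∧-conicalʳ; T-≡; ⇔→≡)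
import Data.Bool.Properties as Bool
open import Data.Sum using (_⊎_; inj₁; inj₂; [_,_]; reduce)
open import Data.Product using (∃-syntax; _×_; _,_; proj₁; proj₂)
open import Data.Empty using (⊥-elim)
open import Function using (_∘_; id)
open import Function.Bundles using (_⇔_; mk⇔; Equivalence)
open import Relation.Binary using (tri<; tri≈; tri>)
open import Relation.Binary.PropositionalEquality hiding ([_])
open import Relation.Nullary using (¬_; yes; no; contradiction)
open import Relation.Nullary.Decidable using (dec-true; _×-dec_)
open import Algebra.Properties.CommutativeSemigroup +-commutativeSemigroup using (interchange)

open Equivalence using (to; from)

_≤ₑ_ : ∀ {n} → Exp n → Exp n → Set
a ≤ₑ b = ∀ i → a i ≤ b i

infixl 25 _+ₑ_

_+ₑ_ : ∀ {n} → Exp n → Exp n → Exp n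
(a +ₑ b) i = a i + b i

ZeroOne : ∀ {n} → Exp n → Set
ZeroOne a = ∀ i → a i ≤ 1

unit-diag : ∀ {n} (i : Fin n) → unit i i ≡ 1
unit-diag i rewrite dec-true (i ≟ i) refl = refl

unit≢0⇒≡ : ∀ {n} {i j : Fin n} → unit i j ≢ 0 → i ≡ j
unit≢0⇒≡ {i = i} {j} u≢0 with i ≟ j
... | yes i≡j = i≡j
... | no _ = ⊥-elim (u≢0 refl)

unit-off : ∀ {n} {i j : Fin n} → i ≢ j → unit i j ≡ 0
unit-off {i = i} {j} i≢j with unit i j ≟ℕ 0
... | yes u≡0 = u≡0
... | no u≢0 = contradiction (unit≢0⇒≡ u≢0) i≢j

01-≡ : ∀ {p q} → p ≤ 1 → q ≤ 1 → (p ≡ 0 → q ≡ 0) → (q ≡ 0 → p ≡ 0) → p ≡ q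
01-≡ z≤n _ p≡0⇒q≡0 _ = sym (p≡0⇒q≡0 refl)
01-≡ _ z≤n _ q≡0⇒p≡0 = q≡0⇒p≡0 refl
01-≡ (s≤s z≤n) (s≤s z≤n) _ _ = refl

01-≢0⇒≡1 : ∀ {p} → p ≤ 1 → p ≢ 0 → p ≡ 1
01-≢0⇒≡1 z≤n p≢0 = contradiction refl p≢0
01-≢0⇒≡1 (s≤s z≤n) _ = refl

+-tight : ∀ {a b x y} → a ≤ x → b ≤ y → x + y ≡ a + b → x ≡ a × y ≡ b
+-tight {a} {b} {x} {y} a≤x b≤y x+y≡a+b = x≡a , +-cancelˡ-≡ x y b (trans x+y≡a+b (cong (_+ b) (sym x≡a)))
  where
  x≡a : x ≡ a
  x≡a = ≤-antisym (+-cancelʳ-≤ y x a (≤-trans (≤-reflexive x+y≡a+b) (+-monoʳ-≤ a b≤y))) a≤x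

⊓-attainedˡ : ∀ {m m′ x} → m ≤ x → x ≡ m ⊓ m′ → x ≡ m × m ≤ m′
⊓-attainedˡ {m} {m′} m≤x x≡m⊓m′ = x≡m , m⊓n≡m⇒m≤n (trans (sym x≡m⊓m′) x≡m)
  where
  x≡m = ≤-antisym (≤-trans (≤-reflexive x≡m⊓m′) (m⊓n≤m m m′)) m≤x

⊓-attainedʳ : ∀ {m m′ x} → m′ ≤ x → x ≡ m ⊓ m′ → x ≡ m′ × m′ ≤ m
⊓-attainedʳ {m} {m′} m′≤x x≡m⊓m′ = ⊓-attainedˡ m′≤x (trans x≡m⊓m′ (⊓-comm m m′))

deg-cong : ∀ {n} {a b : Exp n} → a ≈ₑ b → deg a ≡ deg b
deg-cong {zero} _ = refl
deg-cong {suc n} a≈b = cong₂ _+_ (a≈b zero) (deg-cong (a≈b ∘ suc))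

deg-+ : ∀ {n} (a b : Exp n) → deg (a +ₑ b) ≡ deg a + deg b
deg-+ {zero} _ _ = refl
deg-+ {suc n} a b = trans (cong (a zero + b zero +_) (deg-+ (a ∘ suc) (b ∘ suc)))
                          (interchange (a zero) (b zero) (deg (a ∘ suc)) (deg (b ∘ suc)))

deg-split : ∀ {n} {b c d : Exp n} → b ≈ₑ c +ₑ d → deg b ≡ deg c + deg d
deg-split {c = c} {d} b≈c+d = trans (deg-cong b≈c+d) (deg-+ c d)

deg-zeros : ∀ n → deg {n} (λ _ → 0) ≡ 0
deg-zeros zero = refl
deg-zeros (suc n) = deg-zeros n

deg-unit : ∀ {n} (i : Fin n) → deg (unit i) ≡ 1
deg-unit {suc n} zero = cong suc (deg-zeros n)
deg-unit (suc i) = deg-unit i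

deg-mono : ∀ {n} {a b : Exp n} → a ≤ₑ b → deg a ≤ deg b
deg-mono {zero} _ = z≤n
deg-mono {suc n} a≤b = +-mono-≤ (a≤b zero) (deg-mono (a≤b ∘ suc))

deg-mono-< : ∀ {n} {a b : Exp n} → a ≤ₑ b → ∀ i → a i < b i → deg a < deg b
deg-mono-< {suc n} a≤b zero a₀<b₀ = +-mono-<-≤ a₀<b₀ (deg-mono (a≤b ∘ suc))
deg-mono-< {suc n} a≤b (suc i) aᵢ<bᵢ = +-mono-≤-< (a≤b zero) (deg-mono-< (a≤b ∘ suc) i aᵢ<bᵢ)

≤ₑ∧deg≡⇒≈ₑ : ∀ {n} {a b : Exp n} → a ≤ₑ b → deg a ≡ deg b → a ≈ₑ b
≤ₑ∧deg≡⇒≈ₑ a≤b deg≡ i with m≤n⇒m<n∨m≡n (a≤b i)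
... | inj₁ aᵢ<bᵢ = contradiction deg≡ (λ eq → <-irrefl eq (deg-mono-< a≤b i aᵢ<bᵢ))
... | inj₂ aᵢ≡bᵢ = aᵢ≡bᵢ

_⊆ₛ_ : ∀ {n} → Exp n → (Fin n → Bool) → Set
b ⊆ₛ x = ∀ i → b i ≢ 0 → x i ≡ true

support : ∀ {n} → Exp n → (Fin n → Bool)
support b i = not (b i ≡ᵇ 0)

indicator : ∀ {n} → (Fin n → Bool) → Exp n
indicator x i = if x i then 1 else 0

⊆ₛ-support : ∀ {n} (b : Exp n) → b ⊆ₛ support b
⊆ₛ-support b i bᵢ≢0 with b i
... | zero = contradiction refl bᵢ≢0
... | suc _ = refl

support-true⇒≢0 : ∀ {n} (b : Exp n) i → support b i ≡ true → b i ≢ 0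
support-true⇒≢0 b i eq bᵢ≡0 rewrite bᵢ≡0 = contradiction eq λ ()

bits-true⇒≡1 : ∀ {n} (a : Exp n) i → bits a i ≡ true → a i ≡ 1
bits-true⇒≡1 a i eq = ≡ᵇ⇒≡ (a i) 1 (from T-≡ eq)

bits-true⇒≢0 : ∀ {n} (a : Exp n) i → bits a i ≡ true → a i ≢ 0
bits-true⇒≢0 a i bitᵢ aᵢ≡0 = contradiction (trans (sym aᵢ≡0) (bits-true⇒≡1 a i bitᵢ)) λ ()

≡1⇒bits-true : ∀ {n} (a : Exp n) i → a i ≡ 1 → bits a i ≡ true
≡1⇒bits-true a i aᵢ≡1 = to T-≡ (≡⇒≡ᵇ (a i) 1 aᵢ≡1)

⊆ₛ-bits : ∀ {n} {a : Exp n} → ZeroOne a → a ⊆ₛ bits a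
⊆ₛ-bits {a = a} a01 i aᵢ≢0 = ≡1⇒bits-true a i (01-≢0⇒≡1 (a01 i) aᵢ≢0)

⊆ₛ⇒≤ₑ : ∀ {n} {a b : Exp n} {x} → ZeroOne a → a ⊆ₛ x → (∀ i → x i ≡ true → b i ≢ 0) → a ≤ₑ b
⊆ₛ⇒≤ₑ {a = a} {b} a01 a⊆x x⇒b≢0 i with a i ≟ℕ 0
... | yes aᵢ≡0 = ≤-trans (≤-reflexive aᵢ≡0) z≤n
... | no aᵢ≢0 with b i in bᵢ≡
...   | zero = contradiction bᵢ≡ (x⇒b≢0 i (a⊆x i aᵢ≢0))
...   | suc _ = ≤-trans (a01 i) (s≤s z≤n)

bits-indicator : ∀ {n} (x : Fin n → Bool) i → bits (indicator x) i ≡ x i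
bits-indicator x i with x i
... | true = refl
... | false = refl

indicator-01 : ∀ {n} (x : Fin n → Bool) → ZeroOne (indicator x)
indicator-01 x i with x i
... | true = ≤-refl
... | false = z≤n

⊆ₛ-indicator : ∀ {n} {a : Exp n} {x} → a ≤ₑ indicator x → a ⊆ₛ x
⊆ₛ-indicator {a = a} {x} a≤x i aᵢ≢0 with x i | a≤x i
... | true | _ = refl
... | false | aᵢ≤0 = contradiction (≤-antisym aᵢ≤0 z≤n) aᵢ≢0

-- Evaluation of a circuit through the vectors it produces

∨-true : ∀ {x y} → x ∨ y ≡ true → x ≡ true ⊎ y ≡ true
∨-true {true} _ = inj₁ refl
∨-true {false} eq = inj₂ eq

⊆ₛ-+ˡ : ∀ {n} {b c d : Exp n} {x} → b ≈ₑ c +ₑ d → b ⊆ₛ x → c ⊆ₛ x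
⊆ₛ-+ˡ {c = c} b≈c+d b⊆x i cᵢ≢0 = b⊆x i (λ bᵢ≡0 → cᵢ≢0 (m+n≡0⇒m≡0 (c i) (trans (sym (b≈c+d i)) bᵢ≡0)))

⊆ₛ-+ʳ : ∀ {n} {b c d : Exp n} {x} → b ≈ₑ c +ₑ d → b ⊆ₛ x → d ⊆ₛ x
⊆ₛ-+ʳ {c = c} b≈c+d b⊆x i dᵢ≢0 = b⊆x i (λ bᵢ≡0 → dᵢ≢0 (m+n≡0⇒n≡0 (c i) (trans (sym (b≈c+d i)) bᵢ≡0)))

⊆ₛ-+ : ∀ {n} {c d : Exp n} {x} → c ⊆ₛ x → d ⊆ₛ x → (c +ₑ d) ⊆ₛ x
⊆ₛ-+ {c = c} c⊆x d⊆x i sum≢0 with c i ≟ℕ 0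
... | yes cᵢ≡0 = d⊆x i (λ dᵢ≡0 → sum≢0 (cong₂ _+_ cᵢ≡0 dᵢ≡0))
... | no cᵢ≢0 = c⊆x i cᵢ≢0

Bnode-resp-≈ : ∀ {n k} (G : Gates n k) v {b b′} → Bnode G v b → b ≈ₑ b′ → Bnode G v b′
Bop-resp-≈ : ∀ {n k} (G : Gates n k) g {b b′} → Bop G g b → b ≈ₑ b′ → Bop G g b′
Bnode-resp-≈ G (inj₁ i) b≈eᵢ b≈b′ j = trans (sym (b≈b′ j)) (b≈eᵢ j)
Bnode-resp-≈ (G ▷ g) (inj₂ zero) = Bop-resp-≈ G g
Bnode-resp-≈ (G ▷ g) (inj₂ (suc j)) = Bnode-resp-≈ G (inj₂ j)
Bop-resp-≈ G (gate ⊕ l r) (inj₁ h) b≈b′ = inj₁ (Bnode-resp-≈ G l h b≈b′)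
Bop-resp-≈ G (gate ⊕ l r) (inj₂ h) b≈b′ = inj₂ (Bnode-resp-≈ G r h b≈b′)
Bop-resp-≈ G (gate ⊗ l r) (c , d , hc , hd , b≈c+d) b≈b′ =
  c , d , hc , hd , λ i → trans (sym (b≈b′ i)) (b≈c+d i)

eval-sound : ∀ {n k} (G : Gates n k) v {b x} → Bnode G v b → b ⊆ₛ x → evalNode G v x ≡ true
evalOp-sound : ∀ {n k} (G : Gates n k) g {b x} → Bop G g b → b ⊆ₛ x → evalOp G g x ≡ true
eval-sound G (inj₁ i) b≈eᵢ b⊆x = b⊆x i (subst (_≢ 0) (sym (trans (b≈eᵢ i) (unit-diag i))) λ ())
eval-sound (G ▷ g) (inj₂ zero) = evalOp-sound G g
eval-sound (G ▷ g) (inj₂ (suc j)) = eval-sound G (inj₂ j)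
evalOp-sound G (gate ⊕ l r) (inj₁ h) b⊆x rewrite eval-sound G l h b⊆x = refl
evalOp-sound G (gate ⊕ l r) (inj₂ h) b⊆x rewrite eval-sound G r h b⊆x = ∨-zeroʳ _
evalOp-sound G (gate ⊗ l r) (c , d , hc , hd , b≈c+d) b⊆x
  rewrite eval-sound G l hc (⊆ₛ-+ˡ b≈c+d b⊆x) | eval-sound G r hd (⊆ₛ-+ʳ b≈c+d b⊆x) = refl

eval-complete : ∀ {n k} (G : Gates n k) v {x} → evalNode G v x ≡ true → ∃[ b ] Bnode G v b × b ⊆ₛ x
evalOp-complete : ∀ {n k} (G : Gates n k) g {x} → evalOp G g x ≡ true → ∃[ b ] Bop G g b × b ⊆ₛ x
eval-complete G (inj₁ i) {x} xᵢ≡true =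
  unit i , (λ _ → refl) , λ j uᵢⱼ≢0 → subst (λ k → x k ≡ true) (unit≢0⇒≡ uᵢⱼ≢0) xᵢ≡true
eval-complete (G ▷ g) (inj₂ zero) = evalOp-complete G g
eval-complete (G ▷ g) (inj₂ (suc j)) = eval-complete G (inj₂ j)
evalOp-complete G (gate ⊕ l r) accepted with ∨-true accepted
... | inj₁ l-accepts = let b , hb , b⊆x = eval-complete G l l-accepts in b , inj₁ hb , b⊆x
... | inj₂ r-accepts = let b , hb , b⊆x = eval-complete G r r-accepts in b , inj₂ hb , b⊆x
evalOp-complete G (gate ⊗ l r) accepted =
  let c , hc , c⊆x = eval-complete G l (∧-conicalˡ _ _ accepted)
      d , hd , d⊆x = eval-complete G r (∧-conicalʳ _ _ accepted)
  in c +ₑ d , (c , d , hc , hd , λ _ → refl) , ⊆ₛ-+ c⊆x d⊆x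

B-resp-≈ : ∀ {n s} (C : Circuit n s) {b b′} → B C b → b ≈ₑ b′ → B C b′
B-resp-≈ C = Bnode-resp-≈ (gates C) (output C)

computes-sound : ∀ {n s} {f : BoolFn n} (C : Circuit n s) → Computes C f →
  ∀ {b x} → B C b → b ⊆ₛ x → f x ≡ true
computes-sound C computes {x = x} hb b⊆x = trans (sym (computes x)) (eval-sound (gates C) (output C) hb b⊆x)

computes-complete : ∀ {n s} {f : BoolFn n} (C : Circuit n s) → Computes C f →
  ∀ {x} → f x ≡ true → ∃[ b ] B C b × b ⊆ₛ x
computes-complete C computes {x} fx = eval-complete (gates C) (output C) (trans (computes x) fx)

-- Lowest-degree part of a circuit

Lowest : ∀ {n} → ExpSet n → ℕ → ExpSet n
Lowest A m b = A b × deg b ≡ m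

minDeg : ∀ {n k} → Gates n k → Node n k → ℕ
minDegOp : ∀ {n k} → Gates n k → Gate n k → ℕ
minDeg G (inj₁ i) = 1
minDeg (G ▷ g) (inj₂ zero) = minDegOp G g
minDeg (G ▷ g) (inj₂ (suc j)) = minDeg G (inj₂ j)
minDegOp G (gate ⊕ l r) = minDeg G l ⊓ minDeg G r
minDegOp G (gate ⊗ l r) = minDeg G l + minDeg G r

minDeg≤deg : ∀ {n k} (G : Gates n k) v {b} → Bnode G v b → minDeg G v ≤ deg b
minDegOp≤deg : ∀ {n k} (G : Gates n k) g {b} → Bop G g b → minDegOp G g ≤ deg b
minDeg≤deg G (inj₁ i) b≈eᵢ = ≤-reflexive (sym (trans (deg-cong b≈eᵢ) (deg-unit i)))
minDeg≤deg (G ▷ g) (inj₂ zero) = minDegOp≤deg G g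
minDeg≤deg (G ▷ g) (inj₂ (suc j)) = minDeg≤deg G (inj₂ j)
minDegOp≤deg G (gate ⊕ l r) (inj₁ h) = ≤-trans (m⊓n≤m _ _) (minDeg≤deg G l h)
minDegOp≤deg G (gate ⊕ l r) (inj₂ h) = ≤-trans (m⊓n≤n _ _) (minDeg≤deg G r h)
minDegOp≤deg G (gate ⊗ l r) (c , d , hc , hd , b≈c+d) =
  ≤-trans (+-mono-≤ (minDeg≤deg G l hc) (minDeg≤deg G r hd)) (≤-reflexive (sym (deg-split b≈c+d)))

minDeg-attained : ∀ {n k} (G : Gates n k) v → ∃[ b ] Lowest (Bnode G v) (minDeg G v) b
minDegOp-attained : ∀ {n k} (G : Gates n k) g → ∃[ b ] Lowest (Bop G g) (minDegOp G g) b
minDeg-attained G (inj₁ i) = unit i , (λ _ → refl) , deg-unit i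
minDeg-attained (G ▷ g) (inj₂ zero) = minDegOp-attained G g
minDeg-attained (G ▷ g) (inj₂ (suc j)) = minDeg-attained G (inj₂ j)
minDegOp-attained G (gate ⊕ l r) with ≤-total (minDeg G l) (minDeg G r)
... | inj₁ l≤r = let b , hb , deg≡ = minDeg-attained G l in b , inj₁ hb , trans deg≡ (sym (m≤n⇒m⊓n≡m l≤r))
... | inj₂ r≤l = let b , hb , deg≡ = minDeg-attained G r in b , inj₂ hb , trans deg≡ (sym (m≥n⇒m⊓n≡n r≤l))
minDegOp-attained G (gate ⊗ l r) =
  let c , hc , dc = minDeg-attained G l
      d , hd , dd = minDeg-attained G r
  in c +ₑ d , (c , d , hc , hd , λ _ → refl) , trans (deg-+ c d) (cong₂ _+_ dc dd)

Env⇔Lowest : ∀ {n k} (G : Gates n k) v b → Env (Bnode G v) b ⇔ Lowest (Bnode G v) (minDeg G v) b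
Env⇔Lowest G v b = mk⇔
  (λ (hb , least) → let b₀ , hb₀ , deg≡ = minDeg-attained G v
                    in hb , ≤-antisym (≤-trans (least b₀ hb₀) (≤-reflexive deg≡)) (minDeg≤deg G v hb))
  (λ (hb , deg≡) → hb , λ c hc → ≤-trans (≤-reflexive deg≡) (minDeg≤deg G v hc))

-- The envelope circuit: an ∨-gate keeps only its inputs of least minimal degree, duplicating
-- the survivor when there is just one, so that the number of gates does not change.
envGate : ∀ {n k} → Gates n k → Gate n k → Gate n k
envGate G (gate ⊕ l r) with <-cmp (minDeg G l) (minDeg G r)
... | tri< _ _ _ = gate ⊕ l l
... | tri≈ _ _ _ = gate ⊕ l r
... | tri> _ _ _ = gate ⊕ r r
envGate G (gate ⊗ l r) = gate ⊗ l r

envGates : ∀ {n k} → Gates n k → Gates n k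
envGates [] = []
envGates (G ▷ g) = envGates G ▷ envGate G g

lowest-⊕ˡ : ∀ {n k} (G : Gates n k) l r {b} → minDeg G l ≤ minDeg G r →
  Lowest (Bnode G l) (minDeg G l) b → Lowest (Bop G (gate ⊕ l r)) (minDegOp G (gate ⊕ l r)) b
lowest-⊕ˡ G _ _ l≤r (hb , deg≡) = inj₁ hb , trans deg≡ (sym (m≤n⇒m⊓n≡m l≤r))

lowest-⊕ʳ : ∀ {n k} (G : Gates n k) l r {b} → minDeg G r ≤ minDeg G l →
  Lowest (Bnode G r) (minDeg G r) b → Lowest (Bop G (gate ⊕ l r)) (minDegOp G (gate ⊕ l r)) b
lowest-⊕ʳ G _ _ r≤l (hb , deg≡) = inj₂ hb , trans deg≡ (sym (m≥n⇒m⊓n≡n r≤l))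

envGates-sound : ∀ {n k} (G : Gates n k) v {b} → Bnode (envGates G) v b → Lowest (Bnode G v) (minDeg G v) b
envGate-sound : ∀ {n k} (G : Gates n k) g {b} → Bop (envGates G) (envGate G g) b → Lowest (Bop G g) (minDegOp G g) b
envGates-sound G (inj₁ i) b≈eᵢ = b≈eᵢ , trans (deg-cong b≈eᵢ) (deg-unit i)
envGates-sound (G ▷ g) (inj₂ zero) = envGate-sound G g
envGates-sound (G ▷ g) (inj₂ (suc j)) = envGates-sound G (inj₂ j)
envGate-sound G (gate ⊕ l r) h with <-cmp (minDeg G l) (minDeg G r)
... | tri< l<r _ _ = lowest-⊕ˡ G l r (<⇒≤ l<r) (envGates-sound G l (reduce h))
... | tri≈ _ l≡r _ = [ lowest-⊕ˡ G l r (≤-reflexive l≡r) ∘ envGates-sound G l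
                     , lowest-⊕ʳ G l r (≤-reflexive (sym l≡r)) ∘ envGates-sound G r ] h
... | tri> _ _ r<l = lowest-⊕ʳ G l r (<⇒≤ r<l) (envGates-sound G r (reduce h))
envGate-sound G (gate ⊗ l r) (c , d , hc , hd , b≈c+d) =
  let hc′ , dc = envGates-sound G l hc
      hd′ , dd = envGates-sound G r hd
  in (c , d , hc′ , hd′ , b≈c+d) , trans (deg-split b≈c+d) (cong₂ _+_ dc dd)

envGates-complete : ∀ {n k} (G : Gates n k) v {b} → Lowest (Bnode G v) (minDeg G v) b → Bnode (envGates G) v b
envGate-complete : ∀ {n k} (G : Gates n k) g {b} → Lowest (Bop G g) (minDegOp G g) b → Bop (envGates G) (envGate G g) b
envGates-complete G (inj₁ i) (b≈eᵢ , _) = b≈eᵢ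
envGates-complete (G ▷ g) (inj₂ zero) = envGate-complete G g
envGates-complete (G ▷ g) (inj₂ (suc j)) = envGates-complete G (inj₂ j)
envGate-complete G (gate ⊕ l r) (inj₁ h , deg≡)
  with ⊓-attainedˡ (minDeg≤deg G l h) deg≡ | <-cmp (minDeg G l) (minDeg G r)
... | deg≡l , _ | tri< _ _ _ = inj₁ (envGates-complete G l (h , deg≡l))
... | deg≡l , _ | tri≈ _ _ _ = inj₁ (envGates-complete G l (h , deg≡l))
... | _ , l≤r | tri> _ _ r<l = contradiction l≤r (<⇒≱ r<l)
envGate-complete G (gate ⊕ l r) (inj₂ h , deg≡)
  with ⊓-attainedʳ (minDeg≤deg G r h) deg≡ | <-cmp (minDeg G l) (minDeg G r)
... | _ , r≤l | tri< l<r _ _ = contradiction r≤l (<⇒≱ l<r)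
... | deg≡r , _ | tri≈ _ _ _ = inj₂ (envGates-complete G r (h , deg≡r))
... | deg≡r , _ | tri> _ _ _ = inj₁ (envGates-complete G r (h , deg≡r))
envGate-complete G (gate ⊗ l r) ((c , d , hc , hd , b≈c+d) , deg≡) =
  let dc , dd = +-tight (minDeg≤deg G l hc) (minDeg≤deg G r hd) (trans (sym (deg-split b≈c+d)) deg≡)
  in c , d , envGates-complete G l (hc , dc) , envGates-complete G r (hd , dd) , b≈c+d

ArithSize-resp-⇔ : ∀ {n} {A A′ : ExpSet n} {s} → (∀ b → A b ⇔ A′ b) → ArithSize A s → ArithSize A′ s
ArithSize-resp-⇔ A⇔A′ (C , produces) =
  C , λ b → to (A⇔A′ b) ∘ proj₁ (produces b) , proj₂ (produces b) ∘ from (A⇔A′ b)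

envelope-circuit : ∀ {n s} (C : Circuit n s) → ArithSize (Env (B C)) s
envelope-circuit (circuit G o) =
  circuit (envGates G) o , λ b → from (Env⇔Lowest G o b) ∘ envGates-sound G o
                               , envGates-complete G o ∘ to (Env⇔Lowest G o b)

Env-coinitial : ∀ {n} {A A′ : ExpSet n} →
  (∀ {a b} → A′ a → a ≈ₑ b → A′ b) → (∀ {a} → A′ a → A a) → (∀ {b} → A b → ∃[ a ] A′ a × a ≤ₑ b) →
  ∀ b → Env A b ⇔ Env A′ b
Env-coinitial A′-resp A′⊆A dominates b = mk⇔
  (λ (Ab , least) → let a , A′a , a≤b = dominates Ab
                        a≈b = ≤ₑ∧deg≡⇒≈ₑ a≤b (≤-antisym (deg-mono a≤b) (least a (A′⊆A A′a)))
                    in A′-resp A′a a≈b , λ c A′c → least c (A′⊆A A′c))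
  (λ (A′b , least) → A′⊆A A′b , λ c Ac → let a , A′a , a≤c = dominates Ac
                                         in ≤-trans (least a A′a) (deg-mono a≤c))

Env-homogeneous : ∀ {n} {A : ExpSet n} → (∀ a b → A a → A b → deg a ≡ deg b) → ∀ b → Env A b ⇔ A b
Env-homogeneous sameDeg b = mk⇔ proj₁ λ Ab → Ab , λ c Ac → ≤-reflexive (sameDeg b c Ab Ac)

-- Minterms of a monotone function

remove : ∀ {n} → Fin n → Exp n → Exp n
remove i x j = x j ∸ unit i j

remove-≤ₑ : ∀ {n} i (x : Exp n) → remove i x ≤ₑ x
remove-≤ₑ i x j = m∸n≤m (x j) (unit i j)

remove-off : ∀ {n} {i j} (x : Exp n) → i ≢ j → remove i x j ≡ x j
remove-off {j = j} x i≢j = cong (x j ∸_) (unit-off i≢j)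

remove-deg : ∀ {n} i (x : Exp n) → x i ≡ 1 → deg (remove i x) < deg x
remove-deg i x xᵢ≡1 = deg-mono-< (remove-≤ₑ i x) i (subst₂ _<_ (sym removed) (sym xᵢ≡1) (s≤s z≤n))
  where
  removed : remove i x i ≡ 0
  removed rewrite xᵢ≡1 | unit-diag i = refl

module _ {n} {f : BoolFn n} (mono : Monotone f) where

  f-cong : ∀ {x y} → (∀ i → x i ≡ y i) → f x ≡ f y
  f-cong {x} {y} x≡y = ⇔→≡ {z = true} (mk⇔ (mono x y (λ i → trans (sym (x≡y i))))
                                            (mono y x (λ i → trans (x≡y i))))

  Low-resp-≈ : ∀ {a b} → Low f a → a ≈ₑ b → Low f b
  Low-resp-≈ (a01 , fa , minimal) a≈b =
    (λ i → subst (_≤ 1) (a≈b i) (a01 i)) ,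
    trans (f-cong (λ i → cong (_≡ᵇ 1) (sym (a≈b i)))) fa ,
    λ c c≤b c≉b → minimal c (λ i → subst (c i ≤_) (sym (a≈b i)) (c≤b i))
                            (λ c≈a → c≉b (λ i → trans (c≈a i) (a≈b i)))

  low-minimal : ∀ {a b} → Low f a → b ≤ₑ a → f (bits b) ≡ true → b ≈ₑ a
  low-minimal {a} {b} (_ , _ , minimal) b≤a fb with all? (λ i → b i ≟ℕ a i)
  ... | yes b≈a = b≈a
  ... | no b≉a = contradiction (trans (sym fb) (minimal b b≤a b≉a)) λ ()

  minterm⇒true : ∀ {a x} → Low f a → a ⊆ₛ x → f x ≡ true
  minterm⇒true {a} (_ , fa , _) a⊆x =
    mono (bits a) _ (λ i → a⊆x i ∘ bits-true⇒≢0 a i) fa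

  Removable : Exp n → Fin n → Set
  Removable x i = x i ≡ 1 × f (bits (remove i x)) ≡ true

  below⇒removable : ∀ {x b} → ZeroOne x → b ≤ₑ x → ¬ b ≈ₑ x → f (bits b) ≡ true → ∃[ i ] Removable x i
  below⇒removable {x} {b} x01 b≤x b≉x fb = i , xᵢ≡1 , mono (bits b) (bits (remove i x)) b⊑removed fb
    where
    differs = ¬∀⟶∃¬ n (λ i → b i ≡ x i) (λ i → b i ≟ℕ x i) b≉x
    i = proj₁ differs

    bᵢ<xᵢ : b i < x i
    bᵢ<xᵢ = ≤∧≢⇒< (b≤x i) (proj₂ differs)

    bᵢ≡0 : b i ≡ 0
    bᵢ≡0 = n<1⇒n≡0 (<-≤-trans bᵢ<xᵢ (x01 i))

    xᵢ≡1 : x i ≡ 1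
    xᵢ≡1 = ≤-antisym (x01 i) (subst (_< x i) bᵢ≡0 bᵢ<xᵢ)

    b⊑removed : ∀ j → bits b j ≡ true → bits (remove i x) j ≡ true
    b⊑removed j bitⱼ = ≡1⇒bits-true (remove i x) j
                          (trans (remove-off x i≢j) (≤-antisym (x01 j) (subst (_≤ x j) bⱼ≡1 (b≤x j))))
      where
      bⱼ≡1 = bits-true⇒≡1 b j bitⱼ
      i≢j : i ≢ j
      i≢j i≡j = bits-true⇒≢0 b j bitⱼ (subst (λ k → b k ≡ 0) i≡j bᵢ≡0)

  low-or-removable : ∀ {x} → ZeroOne x → f (bits x) ≡ true → Low f x ⊎ ∃[ i ] Removable x i
  low-or-removable {x} x01 fx with any? (λ i → (x i ≟ℕ 1) ×-dec (f (bits (remove i x)) Bool.≟ true))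
  ... | yes removable = inj₂ removable
  ... | no none = inj₁ (x01 , fx , minimal)
    where
    minimal : ∀ b → b ≤ₑ x → ¬ b ≈ₑ x → f (bits b) ≡ false
    minimal b b≤x b≉x with f (bits b) in fb
    ... | false = refl
    ... | true = contradiction (below⇒removable x01 b≤x b≉x fb) none

  -- m is fuel for the descent: every removal strictly lowers deg x.
  low-below : ∀ m {x} → deg x ≤ m → ZeroOne x → f (bits x) ≡ true → ∃[ a ] Low f a × a ≤ₑ x
  low-below m {x} deg≤m x01 fx with low-or-removable x01 fx
  ... | inj₁ Lx = x , Lx , λ _ → ≤-refl
  ... | inj₂ (i , xᵢ≡1 , f-removed) with m | <-≤-trans (remove-deg i x xᵢ≡1) deg≤m
  ...   | suc m′ | s≤s deg′≤m′ =
          let a , La , a≤ = low-below m′ deg′≤m′ (λ j → ≤-trans (remove-≤ₑ i x j) (x01 j)) f-removed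
          in a , La , λ j → ≤-trans (a≤ j) (remove-≤ₑ i x j)

  true⇒minterm : ∀ {x} → f x ≡ true → ∃[ a ] Low f a × a ⊆ₛ x
  true⇒minterm {x} fx =
    let a , La , a≤x = low-below _ ≤-refl (indicator-01 x) (trans (f-cong (bits-indicator x)) fx)
    in a , La , ⊆ₛ-indicator a≤x

  produced-dominates-minterm : ∀ {s} (C : Circuit n s) → Computes C f → ∀ {b} → B C b → ∃[ a ] Low f a × a ≤ₑ b
  produced-dominates-minterm C computes {b} hb =
    let a , La , a⊆ = true⇒minterm (computes-sound C computes hb (⊆ₛ-support b))
    in a , La , ⊆ₛ⇒≤ₑ (proj₁ La) a⊆ (support-true⇒≢0 b)

  syntactic⇒minterm-produced : ∀ {s} (C : Circuit n s) → Computes C f → IsSynReadK 1 C → ∀ {a} → Low f a → B C a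
  syntactic⇒minterm-produced C computes syntactic {a} La@(_ , fa , _) =
    let b , hb , b⊆a = computes-complete C computes fa
        b01 = syntactic b hb
        b≤a = ⊆ₛ⇒≤ₑ b01 b⊆a (bits-true⇒≢0 a)
    in B-resp-≈ C hb (low-minimal La b≤a (computes-sound C computes hb (⊆ₛ-bits b01)))

  read1⇒minterm-produced : ∀ {s} (C : Circuit n s) → IsReadK 1 C f → ∀ {a} → Low f a → B C a
  read1⇒minterm-produced C read1 La =
    let b , hb , same , b01 = read1 _ La
    in B-resp-≈ C hb
         (λ i → 01-≡ (b01 i) (proj₁ La i) (proj₁ (same i)) (proj₂ (same i)))

  syntactic⇒read1 : ∀ {s} → SReadSize 1 f s → ReadSize 1 f s
  syntactic⇒read1 (C , computes , syntactic) =
    C , computes , λ a La → a , syntactic⇒minterm-produced C computes syntactic La , (λ _ → id , id) , proj₁ La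

  arithLow⇒syntactic : ∀ {s} → ArithSize (Low f) s → SReadSize 1 f s
  arithLow⇒syntactic (C , produces) = C , computes , λ b hb → proj₁ (proj₁ (produces b) hb)
    where
    computes : Computes C f
    computes x = ⇔→≡ {z = true} (mk⇔
      (λ accepted → let b , hb , b⊆x = eval-complete (gates C) (output C) accepted
                    in minterm⇒true (proj₁ (produces b) hb) b⊆x)
      (λ fx → let a , La , a⊆x = true⇒minterm fx
              in eval-sound (gates C) (output C) (proj₂ (produces a) La) a⊆x))

  read1⇒arithEnv : ∀ {s} → ReadSize 1 f s → ArithSize (Env (Low f)) s
  read1⇒arithEnv (C , computes , read1) =
    ArithSize-resp-⇔ (Env-coinitial Low-resp-≈ (read1⇒minterm-produced C read1)
                                                (produced-dominates-minterm C computes))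
                     (envelope-circuit C)

theorem1 : ∀ {n} (f : BoolFn n) → Monotone f → NonConstant f →
    ∀ (arEnv r1 sr1 arLow : ℕ) →
    IsMin (ArithSize (Env (Low f))) arEnv →
    IsMin (ReadSize 1 f) r1 →
    IsMin (SReadSize 1 f) sr1 →
    IsMin (ArithSize (Low f)) arLow →
    (arEnv ≤ r1 × r1 ≤ sr1 × sr1 ≤ arLow) ×
    (Homogeneous f → arLow ≡ r1 × r1 ≡ sr1)
theorem1 f mono _ arEnv r1 sr1 arLow
         (envC , env-least) (readC , read-least) (sreadC , sread-least) (arithC , arith-least) =
  (arEnv≤r1 , r1≤sr1 , sr1≤arLow) , λ homogeneous →
    let arLow≤arEnv = arith-least arEnv (ArithSize-resp-⇔ (Env-homogeneous homogeneous) envC)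
    in ≤-antisym (≤-trans arLow≤arEnv arEnv≤r1) (≤-trans r1≤sr1 sr1≤arLow) ,
       ≤-antisym r1≤sr1 (≤-trans sr1≤arLow (≤-trans arLow≤arEnv arEnv≤r1))
  where
  arEnv≤r1 = env-least r1 (read1⇒arithEnv mono readC)
  r1≤sr1 = read-least sr1 (syntactic⇒read1 mono sreadC)
  sr1≤arLow = sread-least arLow (arithLow⇒syntactic mono arithC)
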